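{- Let $k\ge 4$ be an integer and let $G$ be a path or a cycle with $n(G)>\ell(k-1)$, where $\ell(m)=\frac{m^3-m^2}{2}$. Then $\chi_{NL}(G)\ge k$.
   Context: All graphs are finite, simple, undirected and connected; $n(G)$ is the number of vertices. A $k$-coloring of a graph $G$ is a partition of $V(G)$ into $k$ independent sets (colors). A coloring $\{S_1,\dots,S_k\}$ is neighbor-locating (an NL-coloring) if for any two distinct vertices $u,v$ in the same color class, $\{j: N(u)\cap S_j\neq\emptyset\}\neq\{j: N(v)\cap S_j\neq\emptyset\}$. The neighbor-locating chromatic number $\chi_{NL}(G)$ is the minimum number of colors in an NL-coloring of $G$. -}

module Defs where

open import Data.Nat using (ℕ; suc; _+_; _∸_; _^_; _≤_; _<_)
open import Data.Nat.DivMod using (_/_; _%_)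
open import Data.Fin using (Fin; toℕ)
open import Data.Product using (Σ; _×_; ∃)
open import Data.Sum using (_⊎_)
open import Relation.Binary.PropositionalEquality using (_≡_; _≢_)
open import Relation.Nullary using (¬_)
open import Function.Bundles using (_⇔_)
open import Function.Definitions using (Surjective)

Graph : ℕ → Set₁
Graph n = Fin n → Fin n → Set

Path : (n : ℕ) → Graph n
Path n i j = (toℕ j ≡ suc (toℕ i)) ⊎ (toℕ i ≡ suc (toℕ j))

-- The cycle C_n (meaningful for n ≥ 3): i ~ j iff j ≡ i ± 1 (mod n).
Cycle : (n : ℕ) → Graph n
Cycle 0 i j = Data.Empty.⊥ where import Data.Empty
Cycle (suc m) i j =
  (toℕ j ≡ suc (toℕ i) % suc m) ⊎ (toℕ i ≡ suc (toℕ j) % suc m)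

-- A k-coloring: a partition of V(G) into k (nonempty) independent sets,
-- encoded as a surjective map c : Fin n → Fin k with adjacent vertices
-- receiving different colors.
IsColoring : {n : ℕ} → Graph n → (k : ℕ) → (Fin n → Fin k) → Set
IsColoring {n} G k c =
  Surjective _≡_ _≡_ c × (∀ u v → G u v → c u ≢ c v)

NbrHasColor : {n k : ℕ} → Graph n → (Fin n → Fin k) → Fin n → Fin k → Set
NbrHasColor G c u j = ∃ λ w → G u w × (c w ≡ j)

IsNLColoring : {n : ℕ} → Graph n → (k : ℕ) → (Fin n → Fin k) → Set
IsNLColoring {n} G k c =
  IsColoring G k c ×
  (∀ u v → u ≢ v → c u ≡ c v →
     ¬ (∀ j → NbrHasColor G c u j ⇔ NbrHasColor G c v j))

χNL≥ : {n : ℕ} → Graph n → ℕ → Set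
χNL≥ {n} G k = ∀ m (c : Fin n → Fin m) → IsNLColoring G m c → k ≤ m

ℓ : ℕ → ℕ
ℓ m = (m ^ 3 ∸ m ^ 2) / 2

-- Every vertex u of a path on n ≥ 2 vertices or of a cycle has a "neighbour
-- pair": two (possibly equal) neighbours w₁, w₂ such that every neighbour of
-- u is one of them.  In an NL-coloring c with m+1 colours, a vertex u is then
-- determined by its colour c u together with the unordered pair of colours
-- {c w₁, c w₂}.  Both colours differ from c u (the coloring is proper), so
-- after deleting c u from the palette (punchOut) this pair is an unordered
-- pair with repetition from m colours; there are triangle m = m(m+1)/2 of
-- them.  Hence n ≤ (m+1)·triangle m = ℓ(m+1).  Since ℓ is monotone, an
-- NL-coloring with fewer than k colours forces n ≤ ℓ(k-1), contradicting
-- ℓ(k-1) < n.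

module Submission where

open import Defs
open import Data.Nat using (ℕ; zero; suc; _+_; _*_; _∸_; _^_; _≤_; _<_; z≤n; s≤s; _<?_; _≤?_)
open import Data.Nat.Properties
  using (module ≤-Reasoning; ≤-trans; suc-injective; +-mono-≤; *-mono-≤; ∸-monoˡ-≤;
         <⇒≤; ≰⇒>; ≮⇒≥; <⇒≱; ≤-antisym; *-assoc; m+n∸n≡m; *-distribʳ-+)
open import Data.Nat.DivMod using (_%_; _/_; m*n/n≡m; m<n⇒m%n≡m; n%n≡0; m%n<n)
open import Data.Nat.Tactic.RingSolver using (solve-∀)
open import Data.Fin using (Fin; toℕ; fromℕ; fromℕ<; inject₁; punchOut; combine; cast; _≟_)
  renaming (zero to fzero; suc to fsuc; _≤?_ to _≤ᶠ?_)
open import Data.Fin.Properties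
  using (¬Fin0; toℕ-injective; toℕ<n; toℕ-fromℕ<; toℕ-fromℕ; toℕ-inject₁; toℕ-cast;
         punchOut-cong; punchOut-injective; combine-injective; injective⇒≤)
open import Data.Product using (Σ; _×_; _,_; proj₁; proj₂)
open import Data.Sum using (_⊎_; inj₁; inj₂; [_,_])
open import Data.Empty using (⊥-elim)
open import Data.List using (List; []; _++_; length; allFin)
  renaming (map to mapL)
open import Data.List.Properties using (length-++; length-map; length-tabulate)
open import Data.List.Membership.Propositional using (_∈_)
open import Data.List.Membership.Propositional.Properties using (∈-map⁺; ∈-++⁺ˡ; ∈-++⁺ʳ; ∈-allFin)
open import Data.List.Membership.Setoid.Properties using (index-injective)
open import Data.List.Relation.Unary.Any using (index)
open import Function using (id; _∘′_)
open import Function.Bundles using (_⇔_; mk⇔; Equivalence)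
open import Relation.Binary.PropositionalEquality
  using (_≡_; _≢_; refl; sym; trans; cong; cong₂; subst; subst₂; setoid; module ≡-Reasoning)
open import Relation.Nullary using (yes; no)

-- The triangular number triangle m = m + (m-1) + … + 1 counts the unordered
-- pairs, repetition allowed, of elements of Fin m.
triangle : ℕ → ℕ
triangle zero    = 0
triangle (suc m) = suc m + triangle m

_∈ₚ_ : {A : Set} → A → A × A → Set
r ∈ₚ (p , q) = r ≡ p ⊎ r ≡ q

startingAt0 : ∀ {m} → Fin (suc m) → Fin (suc m) × Fin (suc m)
startingAt0 b = (fzero , b)

shiftPair : ∀ {m} → Fin m × Fin m → Fin (suc m) × Fin (suc m)
shiftPair (a , b) = (fsuc a , fsuc b)

sortedPairs : (m : ℕ) → List (Fin m × Fin m)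
sortedPairs zero    = []
sortedPairs (suc m) = mapL startingAt0 (allFin (suc m)) ++ mapL shiftPair (sortedPairs m)

length-sortedPairs : ∀ m → length (sortedPairs m) ≡ triangle m
length-sortedPairs zero    = refl
length-sortedPairs (suc m) = begin
  length (mapL startingAt0 (allFin (suc m)) ++ mapL shiftPair (sortedPairs m))
    ≡⟨ length-++ (mapL startingAt0 (allFin (suc m))) ⟩
  length (mapL startingAt0 (allFin (suc m))) + length (mapL shiftPair (sortedPairs m))
    ≡⟨ cong₂ _+_ (trans (length-map startingAt0 (allFin (suc m))) (length-tabulate id))
                 (trans (length-map shiftPair (sortedPairs m)) (length-sortedPairs m)) ⟩
  suc m + triangle m ∎
  where open ≡-Reasoning

sortedPairs-complete : ∀ {m} (a b : Fin m) → toℕ a ≤ toℕ b → (a , b) ∈ sortedPairs m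
sortedPairs-complete {suc m} fzero    b        _         =
  ∈-++⁺ˡ (∈-map⁺ startingAt0 (∈-allFin b))
sortedPairs-complete {suc m} (fsuc a) (fsuc b) (s≤s a≤b) =
  ∈-++⁺ʳ (mapL startingAt0 (allFin (suc m))) (∈-map⁺ shiftPair (sortedPairs-complete a b a≤b))

sortPair : ∀ {m} → Fin m → Fin m → Fin m × Fin m
sortPair p q with p ≤ᶠ? q
... | yes _ = (p , q)
... | no  _ = (q , p)

sortPair∈sortedPairs : ∀ {m} (p q : Fin m) → sortPair p q ∈ sortedPairs m
sortPair∈sortedPairs p q with p ≤ᶠ? q
... | yes p≤q = sortedPairs-complete p q p≤q
... | no  p≰q = sortedPairs-complete q p (<⇒≤ (≰⇒> p≰q))

sortPair-members : ∀ {m} (r p q : Fin m) → r ∈ₚ (p , q) ⇔ r ∈ₚ sortPair p q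
sortPair-members r p q with p ≤ᶠ? q
... | yes _ = mk⇔ id id
... | no  _ = mk⇔ swap swap
  where
  swap : ∀ {a b} → r ∈ₚ (a , b) → r ∈ₚ (b , a)
  swap (inj₁ r≡a) = inj₂ r≡a
  swap (inj₂ r≡b) = inj₁ r≡b

pairCode : ∀ {m} → Fin m → Fin m → Fin (triangle m)
pairCode {m} p q = cast (length-sortedPairs m) (index (sortPair∈sortedPairs p q))

pairCode-members : ∀ {m} {p q p′ q′ : Fin m} → pairCode p q ≡ pairCode p′ q′ →
                   ∀ r → r ∈ₚ (p , q) → r ∈ₚ (p′ , q′)
pairCode-members {m} {p} {q} {p′} {q′} codes≡ r r∈pq =
  Equivalence.from (sortPair-members r p′ q′)
    (subst (r ∈ₚ_) sorted≡ (Equivalence.to (sortPair-members r p q) r∈pq))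
  where
  -- cast preserves toℕ, so equal codes are equal positions in the list
  sorted≡ : sortPair p q ≡ sortPair p′ q′
  sorted≡ = index-injective (setoid _) (sortPair∈sortedPairs p q) (sortPair∈sortedPairs p′ q′)
              (toℕ-injective (trans (sym (toℕ-cast _ _)) (trans (cong toℕ codes≡) (toℕ-cast _ _))))

punchOut-∈ₚ : ∀ {m} {x j p q : Fin (suc m)} (x≢j : x ≢ j) (x≢p : x ≢ p) (x≢q : x ≢ q) →
              j ∈ₚ (p , q) ⇔ punchOut x≢j ∈ₚ (punchOut x≢p , punchOut x≢q)
punchOut-∈ₚ {x = x} {j} {p} {q} x≢j x≢p x≢q = mk⇔ to from
  where
  to : j ∈ₚ (p , q) → punchOut x≢j ∈ₚ (punchOut x≢p , punchOut x≢q)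
  to (inj₁ j≡p) = inj₁ (punchOut-cong x j≡p)
  to (inj₂ j≡q) = inj₂ (punchOut-cong x j≡q)
  from : punchOut x≢j ∈ₚ (punchOut x≢p , punchOut x≢q) → j ∈ₚ (p , q)
  from (inj₁ eq) = inj₁ (punchOut-injective x≢j x≢p eq)
  from (inj₂ eq) = inj₂ (punchOut-injective x≢j x≢q eq)

-- The code of an unordered pair {p, q} of colours from m+1 colours that both
-- avoid a given colour x; only m colours remain available for them.
avoidingCode : ∀ {m} {x p q : Fin (suc m)} → x ≢ p → x ≢ q → Fin (triangle m)
avoidingCode x≢p x≢q = pairCode (punchOut x≢p) (punchOut x≢q)

avoidingCode-members : ∀ {m} {x x′ p q p′ q′ : Fin (suc m)} → x ≡ x′ →
  (x≢p : x ≢ p) (x≢q : x ≢ q) (x′≢p′ : x′ ≢ p′) (x′≢q′ : x′ ≢ q′) →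
  avoidingCode x≢p x≢q ≡ avoidingCode x′≢p′ x′≢q′ →
  ∀ j → j ∈ₚ (p , q) → j ∈ₚ (p′ , q′)
avoidingCode-members {x = x} refl x≢p x≢q x≢p′ x≢q′ codes≡ j j∈pq with x ≟ j
... | yes refl = ⊥-elim ([ x≢p , x≢q ] j∈pq)
... | no x≢j =
  Equivalence.from (punchOut-∈ₚ x≢j x≢p′ x≢q′)
    (pairCode-members codes≡ (punchOut x≢j) (Equivalence.to (punchOut-∈ₚ x≢j x≢p x≢q) j∈pq))

record NeighbourPair {n : ℕ} (G : Graph n) (u : Fin n) : Set where
  constructor mkNeighbourPair
  field
    left      : Fin n
    right     : Fin n
    left-adj  : G u left
    right-adj : G u right
    only      : ∀ w → G u w → w ∈ₚ (left , right)

DegreeOneOrTwo : {n : ℕ} → Graph n → Set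
DegreeOneOrTwo G = ∀ u → NeighbourPair G u

module NLColoringBound {n m : ℕ} (G : Graph n) (nbrs : DegreeOneOrTwo G)
                       (c : Fin n → Fin (suc m)) (nl : IsNLColoring G (suc m) c) where
  open NeighbourPair

  proper : ∀ u v → G u v → c u ≢ c v
  proper = proj₂ (proj₁ nl)

  neighbourColours : ∀ u j → NbrHasColor G c u j ⇔ j ∈ₚ (c (left (nbrs u)) , c (right (nbrs u)))
  neighbourColours u j = mk⇔ to from
    where
    to : NbrHasColor G c u j → j ∈ₚ (c (left (nbrs u)) , c (right (nbrs u)))
    to (w , u~w , cw≡j) with only (nbrs u) w u~w
    ... | inj₁ refl = inj₁ (sym cw≡j)
    ... | inj₂ refl = inj₂ (sym cw≡j)
    from : j ∈ₚ (c (left (nbrs u)) , c (right (nbrs u))) → NbrHasColor G c u j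
    from (inj₁ j≡cl) = left (nbrs u) , left-adj (nbrs u) , sym j≡cl
    from (inj₂ j≡cr) = right (nbrs u) , right-adj (nbrs u) , sym j≡cr

  neighbourCode : Fin n → Fin (triangle m)
  neighbourCode u = avoidingCode (proper u _ (left-adj (nbrs u))) (proper u _ (right-adj (nbrs u)))

  sameNeighbourColours : ∀ {u v} → c u ≡ c v → neighbourCode u ≡ neighbourCode v →
                         ∀ j → NbrHasColor G c u j → NbrHasColor G c v j
  sameNeighbourColours {u} {v} cu≡cv codes≡ j =
    Equivalence.from (neighbourColours v j)
    ∘′ avoidingCode-members cu≡cv _ _ _ _ codes≡ j
    ∘′ Equivalence.to (neighbourColours u j)

  vertexCode : Fin n → Fin (suc m * triangle m)
  vertexCode u = combine (c u) (neighbourCode u)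

  -- The NL property is exactly what makes the vertex code injective.
  vertexCode-injective : ∀ {u v} → vertexCode u ≡ vertexCode v → u ≡ v
  vertexCode-injective {u} {v} codes≡ with u ≟ v
  ... | yes u≡v = u≡v
  ... | no  u≢v = ⊥-elim (proj₂ nl u v u≢v cu≡cv λ j →
          mk⇔ (sameNeighbourColours cu≡cv nu≡nv j) (sameNeighbourColours (sym cu≡cv) (sym nu≡nv) j))
    where
    cu≡cv : c u ≡ c v
    cu≡cv = proj₁ (combine-injective (c u) (neighbourCode u) (c v) (neighbourCode v) codes≡)
    nu≡nv : neighbourCode u ≡ neighbourCode v
    nu≡nv = proj₂ (combine-injective (c u) (neighbourCode u) (c v) (neighbourCode v) codes≡)

  vertexCount≤ : n ≤ suc m * triangle m
  vertexCount≤ = injective⇒≤ vertexCode-injective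

triangle-double : ∀ m → triangle m * 2 ≡ m * suc m
triangle-double zero    = refl
triangle-double (suc m) = begin
  (suc m + triangle m) * 2      ≡⟨ *-distribʳ-+ 2 (suc m) (triangle m) ⟩
  suc m * 2 + triangle m * 2    ≡⟨ cong (suc m * 2 +_) (triangle-double m) ⟩
  suc m * 2 + m * suc m         ≡⟨ factor m ⟩
  suc m * suc (suc m)           ∎
  where
  open ≡-Reasoning
  factor : ∀ i → suc i * 2 + i * suc i ≡ suc i * suc (suc i)
  factor = solve-∀

-- (j+1)³ = (j+1)·(j(j+1)) + (j+1)².
-- The exponents are unfolded (x ^ 3 = x * (x * (x * 1))) for the ring solver.
cube-split : ∀ j → suc j ^ 3 ≡ suc j * (j * suc j) + suc j ^ 2
cube-split = expanded
  where
  expanded : ∀ j → suc j * (suc j * (suc j * 1)) ≡ suc j * (j * suc j) + suc j * (suc j * 1)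
  expanded = solve-∀

ℓ-suc : ∀ m → ℓ (suc m) ≡ suc m * triangle m
ℓ-suc m = begin
  (suc m ^ 3 ∸ suc m ^ 2) / 2                     ≡⟨ cong (λ t → (t ∸ suc m ^ 2) / 2) (cube-split m) ⟩
  (suc m * (m * suc m) + suc m ^ 2 ∸ suc m ^ 2) / 2 ≡⟨ cong (_/ 2) (m+n∸n≡m (suc m * (m * suc m)) (suc m ^ 2)) ⟩
  suc m * (m * suc m) / 2                         ≡⟨ cong (λ t → suc m * t / 2) (sym (triangle-double m)) ⟩
  suc m * (triangle m * 2) / 2                    ≡⟨ cong (_/ 2) (sym (*-assoc (suc m) (triangle m) 2)) ⟩
  suc m * triangle m * 2 / 2                      ≡⟨ m*n/n≡m (suc m * triangle m) 2 ⟩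
  suc m * triangle m                              ∎
  where open ≡-Reasoning

triangle-mono : ∀ {a b} → a ≤ b → triangle a ≤ triangle b
triangle-mono {zero}          _         = z≤n
triangle-mono {suc a} {suc b} (s≤s a≤b) = +-mono-≤ (s≤s a≤b) (triangle-mono a≤b)

ℓ-mono : ∀ {a b} → a ≤ b → ℓ a ≤ ℓ b
ℓ-mono {zero}          _         = z≤n
ℓ-mono {suc a} {suc b} (s≤s a≤b) =
  subst₂ _≤_ (sym (ℓ-suc a)) (sym (ℓ-suc b)) (*-mono-≤ (s≤s a≤b) (triangle-mono a≤b))

path-next : ∀ {n} (u : Fin n) (lt : suc (toℕ u) < n) → Path n u (fromℕ< lt)
path-next u lt = inj₁ (toℕ-fromℕ< lt)

path-next-unique : ∀ {n} {u w : Fin n} (lt : suc (toℕ u) < n) → toℕ w ≡ suc (toℕ u) → w ≡ fromℕ< lt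
path-next-unique lt w≡u+1 = toℕ-injective (trans w≡u+1 (sym (toℕ-fromℕ< lt)))

path-prev : ∀ {n} (i : Fin n) → Path (suc n) (fsuc i) (inject₁ i)
path-prev i = inj₂ (cong suc (sym (toℕ-inject₁ i)))

path-prev-unique : ∀ {n} {i : Fin n} {w : Fin (suc n)} → suc (toℕ i) ≡ suc (toℕ w) → w ≡ inject₁ i
path-prev-unique {i = i} i+1≡w+1 = toℕ-injective (trans (sym (suc-injective i+1≡w+1)) (sym (toℕ-inject₁ i)))

pathNeighbours : ∀ {n} → 2 ≤ n → DegreeOneOrTwo (Path n)
pathNeighbours {suc n} 2≤n u with suc (toℕ u) <? suc n
pathNeighbours 2≤n fzero    | yes lt =
  mkNeighbourPair _ _ (path-next fzero lt) (path-next fzero lt) only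
  where
  only : ∀ w → Path _ fzero w → w ∈ₚ (fromℕ< lt , fromℕ< lt)
  only w (inj₁ w≡1) = inj₁ (path-next-unique lt w≡1)
pathNeighbours 2≤n fzero    | no ¬lt = ⊥-elim (¬lt 2≤n)
pathNeighbours 2≤n (fsuc i) | yes lt =
  mkNeighbourPair _ _ (path-prev i) (path-next (fsuc i) lt) only
  where
  only : ∀ w → Path _ (fsuc i) w → w ∈ₚ (inject₁ i , fromℕ< lt)
  only w (inj₁ w≡u+1) = inj₂ (path-next-unique lt w≡u+1)
  only w (inj₂ u≡w+1) = inj₁ (path-prev-unique u≡w+1)
pathNeighbours 2≤n (fsuc i) | no ¬lt =
  mkNeighbourPair _ _ (path-prev i) (path-prev i) only
  where
  only : ∀ w → Path _ (fsuc i) w → w ∈ₚ (inject₁ i , inject₁ i)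
  only w (inj₁ w≡u+1) = ⊥-elim (¬lt (subst (_< _) w≡u+1 (toℕ<n w)))
  only w (inj₂ u≡w+1) = inj₁ (path-prev-unique u≡w+1)

suc-mod : ∀ {N} t → t < suc N → suc t % suc N ≡ suc t ⊎ (suc t ≡ suc N × suc t % suc N ≡ 0)
suc-mod {N} t t<N with suc t <? suc N
... | yes t+1<N = inj₁ (m<n⇒m%n≡m t+1<N)
... | no  t+1≮N with ≤-antisym t<N (≮⇒≥ t+1≮N)
...   | refl = inj₂ (refl , n%n≡0 (suc t))

suc-mod-injective : ∀ {N s t} → s < suc N → t < suc N → suc s % suc N ≡ suc t % suc N → s ≡ t
suc-mod-injective {N} {s} {t} s<N t<N eq with suc-mod s s<N | suc-mod t t<N
... | inj₁ s′≡ | inj₁ t′≡             = suc-injective (trans (sym s′≡) (trans eq t′≡))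
... | inj₂ (s+1≡N , _) | inj₂ (t+1≡N , _) = suc-injective (trans s+1≡N (sym t+1≡N))
... | inj₁ s′≡ | inj₂ (_ , t′≡0) with trans (sym s′≡) (trans eq t′≡0)
...   | ()
suc-mod-injective s<N t<N eq | inj₂ (_ , s′≡0) | inj₁ t′≡ with trans (sym t′≡) (trans (sym eq) s′≡0)
...   | ()

cycle-prev : ∀ {m} (u : Fin (suc m)) → Σ (Fin (suc m)) λ w → toℕ u ≡ suc (toℕ w) % suc m
cycle-prev {m}     fzero    = fromℕ m , sym (trans (cong (λ t → suc t % suc m) (toℕ-fromℕ m)) (n%n≡0 (suc m)))
cycle-prev {suc m} (fsuc i) = inject₁ i ,
  sym (trans (cong (λ t → suc t % suc (suc m)) (toℕ-inject₁ i)) (m<n⇒m%n≡m (s≤s (toℕ<n i))))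

cycleNeighbours : ∀ n → DegreeOneOrTwo (Cycle n)
cycleNeighbours zero    ()
cycleNeighbours (suc m) u =
  mkNeighbourPair next prev (inj₁ (toℕ-fromℕ< next<N)) (inj₂ u≡prev+1) only
  where
  next<N : suc (toℕ u) % suc m < suc m
  next<N = m%n<n (suc (toℕ u)) (suc m)
  next : Fin (suc m)
  next = fromℕ< next<N
  prev : Fin (suc m)
  prev = proj₁ (cycle-prev u)
  u≡prev+1 : toℕ u ≡ suc (toℕ prev) % suc m
  u≡prev+1 = proj₂ (cycle-prev u)
  only : ∀ w → Cycle (suc m) u w → w ∈ₚ (next , prev)
  only w (inj₁ w≡u+1) = inj₁ (toℕ-injective (trans w≡u+1 (sym (toℕ-fromℕ< next<N))))
  only w (inj₂ u≡w+1) = inj₂ (toℕ-injective (suc-mod-injective (toℕ<n w) (toℕ<n prev) (trans (sym u≡w+1) u≡prev+1)))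

χNL≥-degreeOneOrTwo : ∀ {n} (G : Graph n) → DegreeOneOrTwo G → ∀ k → ℓ (k ∸ 1) < n → χNL≥ G k
χNL≥-degreeOneOrTwo {suc n} G nbrs k ℓ<n zero    c nl = ⊥-elim (¬Fin0 (c fzero))
χNL≥-degreeOneOrTwo {suc n} G nbrs k ℓ<n (suc m) c nl with k ≤? suc m
... | yes k≤m+1 = k≤m+1
... | no  k≰m+1 = ⊥-elim (<⇒≱ ℓ<n (begin
  suc n              ≤⟨ NLColoringBound.vertexCount≤ G nbrs c nl ⟩
  suc m * triangle m ≡⟨ sym (ℓ-suc m) ⟩
  ℓ (suc m)          ≤⟨ ℓ-mono (∸-monoˡ-≤ 1 (≰⇒> k≰m+1)) ⟩
  ℓ (k ∸ 1)          ∎))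
  where open ≤-Reasoning

corollary4 : (k n : ℕ) → 4 ≤ k → ℓ (k ∸ 1) < n →
    χNL≥ (Path n) k × χNL≥ (Cycle n) k
corollary4 k n 4≤k ℓ<n =
  χNL≥-degreeOneOrTwo (Path n) (pathNeighbours 2≤n) k ℓ<n ,
  χNL≥-degreeOneOrTwo (Cycle n) (cycleNeighbours n) k ℓ<n
  where
  -- n > ℓ(k-1) ≥ ℓ(3) = 9, so the path has no isolated vertex.
  2≤n : 2 ≤ n
  2≤n = ≤-trans (s≤s (s≤s z≤n)) (≤-trans (s≤s (ℓ-mono {3} (∸-monoˡ-≤ 1 4≤k))) ℓ<n)
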